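{- Let $p\in\mathcal P$ and let $m$ be a positive integer coprime to $p$ such that $pm\equiv 1\pmod{24}$. Let $$X_{p,m}=\{(x,y)\in\mathbb Z^2: x^2+216y^2=pm,\ \gcd(x,y)=1\}.$$ Then $|X_{p,m}|\equiv 0\pmod 8$ if $m>1$, and $|X_{p,m}|=4$ if $m=1$.
   Context: A solution $(x,y)\in\mathbb Z^2$ of a Diophantine equation is called primitive if $\gcd(x,y)=1$. $\mathcal P$ denotes the set of primes $p$ such that for some $j\in\{1,4,8\}$ the equation $x^2+216y^2=jp$ has a primitive solution. -}

module Defs where

open import Data.Nat as ℕ using (ℕ)
open import Data.Nat.Primality using (Prime)
open import Data.Integer as ℤ using (ℤ; +_)
open import Data.Integer.GCD using (gcd)
open import Data.Fin using (Fin)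
open import Data.Product using (Σ; ∃; _×_; _,_)
open import Data.Sum using (_⊎_)
open import Function.Bundles using (_↔_)
open import Relation.Binary.PropositionalEquality using (_≡_)

Q : ℤ → ℤ → ℤ
Q x y = x ℤ.* x ℤ.+ (+ 216) ℤ.* (y ℤ.* y)

PrimSol : ℤ → ℤ × ℤ → Set
PrimSol N (x , y) = (Q x y ≡ N) × (gcd x y ≡ + 1)

InP : ℕ → Set
InP p = Prime p × ∃ λ (j : ℕ) → ((j ≡ 1) ⊎ (j ≡ 4) ⊎ (j ≡ 8))
          × ∃ λ (s : ℤ × ℤ) → PrimSol (+ (j ℕ.* p)) s

X : ℕ → ℕ → ℤ × ℤ → Set
X p m = PrimSol (+ (p ℕ.* m))

HasCard : {A : Set} → (A → Set) → ℕ → Set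
HasCard {A} S n = Fin n ↔ Σ A S

module Submission where

-- Write z = x + y√-216 ∈ ℤ[√-216], with norm N(z) = x² + 216y². Membership p ∈ 𝒫 yields w = u + v√-216
-- of norm p² with p ∤ v: the square of a primitive solution of x² + 216y² = jp, divided by j. For a
-- primitive z with N(z) = pm exactly one of z·w, z·w̄ is divisible by p, and the quotient is again a
-- primitive solution. This involution commutes with the sign changes (x , y) ↦ (±x , ±y), so it descends
-- to the positive solutions. A positive solution fixed there would make m divide x² − 216y² as well as
-- x² + 216y², hence 2x² and 432y², which forces m = 1 since m is prime to 6 and x to y. So for m > 1 the
-- positive solutions pair off and |X| = 4·#positive is divisible by 8. For m = 1 there is exactly one
-- positive solution: it exists because j = 8 is impossible mod 3 and for j = 4 both coordinates are even,
-- and it is unique because for two solutions z₁, z₂ of norm p one of z₁z₂, z₁z̄₂ has norm p² and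
-- imaginary part divisible by p, hence imaginary part 0.

module Cardinality where

  open import Data.Nat as ℕ using (ℕ; zero; suc; _+_; _*_)
  import Data.Nat.Properties as ℕP
  open import Data.Nat.Divisibility using (_∣_; divides)
  open import Data.Fin using (Fin; zero; suc; toℕ; fromℕ<; _<_)
  open import Data.Fin.Properties
    using (+↔⊎; *↔×; toℕ-fromℕ<; toℕ-injective; <-cmp; <-asym; <-irrelevant; _<?_)
  open import Data.Fin.Permutation using (↔⇒≡)
  open import Data.Product using (Σ; ∃; _×_; _,_; proj₁; proj₂)
  open import Data.Product.Function.Dependent.Propositional using (Σ-↔)
  open import Data.Sum using (_⊎_; inj₁; inj₂)
  open import Data.Sum.Function.Propositional using (_⊎-↔_)
  open import Data.Empty using (⊥-elim)
  open import Function using (_∘_)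
  open import Function.Bundles using (_↔_; Inverse; mk↔ₛ′)
  open import Function.Definitions using (Injective)
  open import Function.Construct.Composition using (_↔-∘_)
  open import Function.Construct.Symmetry using (↔-sym)
  open import Function.Properties.Inverse using (↔-refl)
  open import Level using (0ℓ)
  open import Relation.Binary using (tri<; tri≈; tri>)
  open import Relation.Nullary using (Dec; yes; no; contradiction; Irrelevant)
  open import Relation.Unary using (Pred; Decidable)
  open import Relation.Binary.PropositionalEquality

  Finite : Set → Set
  Finite A = ∃ λ n → Fin n ↔ A

  Σ-≡-irrelevant : ∀ {A : Set} {P : Pred A 0ℓ} → (∀ a → Irrelevant (P a)) →
                   ∀ {a b} {pa : P a} {pb : P b} → a ≡ b → (a , pa) ≡ (b , pb)
  Σ-≡-irrelevant P-irr {a} refl = cong (a ,_) (P-irr a _ _)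

  finite-↔ : ∀ {A B : Set} → A ↔ B → Finite A → Finite B
  finite-↔ A↔B (n , e) = n , A↔B ↔-∘ e

  finite-⊎ : ∀ {A B : Set} → Finite A → Finite B → Finite (A ⊎ B)
  finite-⊎ (m , e) (n , f) = m + n , (e ⊎-↔ f) ↔-∘ +↔⊎

  finite-proposition : ∀ {A : Set} → Dec A → Irrelevant A → Finite A
  finite-proposition (yes a) A-irr = 1 , mk↔ₛ′ (λ _ → a) (λ _ → zero) (A-irr a) λ { zero → refl }
  finite-proposition (no ¬a) _     = 0 , mk↔ₛ′ (λ ()) (⊥-elim ∘ ¬a) (⊥-elim ∘ ¬a) λ ()

  Σ-Fin-suc-↔ : ∀ {k} (P : Pred (Fin (suc k)) 0ℓ) → (P zero ⊎ Σ (Fin k) (P ∘ suc)) ↔ Σ (Fin (suc k)) P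
  Σ-Fin-suc-↔ P = mk↔ₛ′ to from to∘from from∘to
    where
    to : P zero ⊎ Σ _ (P ∘ suc) → Σ _ P
    to (inj₁ p)       = zero , p
    to (inj₂ (i , p)) = suc i , p
    from : Σ _ P → P zero ⊎ Σ _ (P ∘ suc)
    from (zero , p)  = inj₁ p
    from (suc i , p) = inj₂ (i , p)
    to∘from : ∀ x → to (from x) ≡ x
    to∘from (zero , _)  = refl
    to∘from (suc _ , _) = refl
    from∘to : ∀ x → from (to x) ≡ x
    from∘to (inj₁ _) = refl
    from∘to (inj₂ _) = refl

  finite-Σ-Fin : ∀ {k} {P : Pred (Fin k) 0ℓ} → Decidable P → (∀ i → Irrelevant (P i)) →
                 Finite (Σ (Fin k) P)
  finite-Σ-Fin {zero}  _ _ = 0 , mk↔ₛ′ (λ ()) (λ { (() , _) }) (λ { (() , _) }) (λ ())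
  finite-Σ-Fin {suc k} {P} P? P-irr = finite-↔ (Σ-Fin-suc-↔ P)
    (finite-⊎ (finite-proposition (P? zero) (P-irr zero)) (finite-Σ-Fin (P? ∘ suc) (P-irr ∘ suc)))

  Σ-restrict-↔ : ∀ {A C : Set} {P : Pred A 0ℓ} (f : C → A) → Injective _≡_ _≡_ f →
                 (∀ {a} → P a → ∃ λ c → f c ≡ a) → (∀ a → Irrelevant (P a)) →
                 Σ C (P ∘ f) ↔ Σ A P
  Σ-restrict-↔ {P = P} f f-injective preimage P-irr = mk↔ₛ′ to from to∘from from∘to
    where
    to : Σ _ (P ∘ f) → Σ _ P
    to (c , p) = f c , p
    from : Σ _ P → Σ _ (P ∘ f)
    from (a , p) = proj₁ (preimage p) , subst P (sym (proj₂ (preimage p))) p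
    to∘from : ∀ x → to (from x) ≡ x
    to∘from (a , p) = Σ-≡-irrelevant P-irr (proj₂ (preimage p))
    from∘to : ∀ x → from (to x) ≡ x
    from∘to (c , p) = Σ-≡-irrelevant (P-irr ∘ f) (f-injective (proj₂ (preimage p)))

  finite-bounded-pairs : ∀ {P : Pred (ℕ × ℕ) 0ℓ} (B : ℕ) → Decidable P → (∀ z → Irrelevant (P z)) →
                         (∀ {a b} → P (a , b) → a ℕ.< B × b ℕ.< B) → Finite (Σ (ℕ × ℕ) P)
  finite-bounded-pairs {P} B P? P-irr bounded =
    finite-↔ (Σ-restrict-↔ toℕ² toℕ²-injective preimage P-irr ↔-∘ Σ-↔ *↔× ↔-refl)
      (finite-Σ-Fin (P? ∘ toℕ² ∘ Inverse.to *↔×) (P-irr ∘ toℕ² ∘ Inverse.to *↔×))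
    where
    toℕ² : Fin B × Fin B → ℕ × ℕ
    toℕ² (i , j) = toℕ i , toℕ j
    toℕ²-injective : Injective _≡_ _≡_ toℕ²
    toℕ²-injective eq = cong₂ _,_ (toℕ-injective (cong proj₁ eq)) (toℕ-injective (cong proj₂ eq))
    preimage : ∀ {z} → P z → ∃ λ c → toℕ² c ≡ z
    preimage p = (fromℕ< (proj₁ (bounded p)) , fromℕ< (proj₂ (bounded p))) ,
                 cong₂ _,_ (toℕ-fromℕ< _) (toℕ-fromℕ< _)

  free-involution-split : ∀ {n} (ι : Fin n → Fin n) → (∀ i → ι (ι i) ≡ i) → (∀ i → ι i ≢ i) →
                          Fin n ↔ (Σ (Fin n) (λ i → i < ι i) ⊎ Σ (Fin n) (λ i → i < ι i))
  free-involution-split {n} ι ι-involutive ι-free = mk↔ₛ′ to from to∘from from∘to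
    where
    H = Σ (Fin n) (λ i → i < ι i)
    to : Fin n → H ⊎ H
    to i with <-cmp i (ι i)
    ... | tri< i<ιi _ _ = inj₁ (i , i<ιi)
    ... | tri≈ _ i≡ιi _ = contradiction (sym i≡ιi) (ι-free i)
    ... | tri> _ _ ιi<i = inj₂ (ι i , subst (ι i <_) (sym (ι-involutive i)) ιi<i)
    from : H ⊎ H → Fin n
    from (inj₁ (i , _)) = i
    from (inj₂ (i , _)) = ι i
    to∘from : ∀ x → to (from x) ≡ x
    to∘from (inj₁ (i , i<ιi)) with <-cmp i (ι i)
    ... | tri< _ _ _     = cong inj₁ (Σ-≡-irrelevant (λ _ → <-irrelevant) refl)
    ... | tri≈ _ i≡ιi _  = contradiction (sym i≡ιi) (ι-free i)
    ... | tri> ¬i<ιi _ _ = contradiction i<ιi ¬i<ιi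
    to∘from (inj₂ (i , i<ιi)) with <-cmp (ι i) (ι (ι i))
    ... | tri< ιi<i _ _     = contradiction (subst (ι i <_) (ι-involutive i) ιi<i) (<-asym i<ιi)
    ... | tri≈ _ ιi≡ιιi _   = contradiction (sym ιi≡ιιi) (ι-free (ι i))
    ... | tri> _ _ _        = cong inj₂ (Σ-≡-irrelevant (λ _ → <-irrelevant) (ι-involutive i))
    from∘to : ∀ i → from (to i) ≡ i
    from∘to i with <-cmp i (ι i)
    ... | tri< _ _ _    = refl
    ... | tri≈ _ i≡ιi _ = contradiction (sym i≡ιi) (ι-free i)
    ... | tri> _ _ _    = ι-involutive i

  free-involution⇒even : ∀ {n} {A : Set} → Fin n ↔ A → (ι : A → A) →
                         (∀ a → ι (ι a) ≡ a) → (∀ a → ι a ≢ a) → 2 ∣ n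
  free-involution⇒even {n} e ι ι-involutive ι-free =
    divides d (trans (↔⇒≡ (↔-sym H⊎H↔ ↔-∘ free-involution-split ι′ ι′-involutive ι′-free))
                     (d+d≡d*2 d))
    where
    open Inverse e
    ι′ : Fin n → Fin n
    ι′ = from ∘ ι ∘ to
    ι′-involutive : ∀ i → ι′ (ι′ i) ≡ i
    ι′-involutive i =
      trans (cong (from ∘ ι) (strictlyInverseˡ _))
            (trans (cong from (ι-involutive (to i))) (strictlyInverseʳ i))
    ι′-free : ∀ i → ι′ i ≢ i
    ι′-free i eq = ι-free (to i) (trans (sym (strictlyInverseˡ _)) (cong to eq))
    H-finite = finite-Σ-Fin (λ i → i <? ι′ i) (λ _ → <-irrelevant)
    d = proj₁ H-finite
    H⊎H↔ = proj₂ (finite-⊎ H-finite H-finite)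
    d+d≡d*2 : ∀ k → k + k ≡ k * 2
    d+d≡d*2 k = trans (cong (k +_) (sym (ℕP.+-identityʳ k))) (ℕP.*-comm 2 k)

  contractible⇒card≡1 : ∀ {n} {A : Set} → Fin n ↔ A → A → (∀ (x y : A) → x ≡ y) → n ≡ 1
  contractible⇒card≡1 e a A-irr = ↔⇒≡ (↔-sym (proj₂ (finite-proposition (yes a) A-irr)) ↔-∘ e)

module Signs where

  open Cardinality using (Σ-≡-irrelevant)
  open import Data.Nat as ℕ using (ℕ; zero; suc; _*_)
  open import Data.Integer.Base using (ℤ; +_; ∣_∣; sign; _◃_)
  open import Data.Integer.Properties using (◃-inverse; sign-◃; abs-◃)
  open import Data.Sign.Base as Sign using (Sign)
  open import Data.Fin using (Fin; zero; suc)
  open import Data.Fin.Properties using (*↔×)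
  open import Data.Product using (Σ; _×_; _,_; proj₁; proj₂)
  open import Data.Product.Function.NonDependent.Propositional using (_×-↔_)
  open import Function using (_∘_)
  open import Function.Bundles using (_↔_; mk↔ₛ′)
  open import Function.Construct.Composition using (_↔-∘_)
  open import Function.Properties.Inverse using (↔-refl)
  open import Level using (0ℓ)
  open import Relation.Nullary using (Irrelevant)
  open import Relation.Unary using (Pred)
  open import Relation.Binary.PropositionalEquality

  abs : ℤ × ℤ → ℕ × ℕ
  abs (x , y) = ∣ x ∣ , ∣ y ∣

  embed : ℕ × ℕ → ℤ × ℤ
  embed (a , b) = + a , + b

  2↔Sign : Fin 2 ↔ Sign
  2↔Sign = mk↔ₛ′ (λ { zero → Sign.- ; (suc zero) → Sign.+ }) (λ { Sign.- → zero ; Sign.+ → suc zero })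
                 (λ { Sign.- → refl ; Sign.+ → refl }) (λ { zero → refl ; (suc zero) → refl })

  sign-decomposition : {S : Pred (ℤ × ℤ) 0ℓ} → (∀ z → Irrelevant (S z)) →
                       (∀ z z′ → abs z ≡ abs z′ → S z → S z′) →
                       (∀ a b → S (embed (a , b)) → ℕ.NonZero a × ℕ.NonZero b) →
                       Σ (ℤ × ℤ) S ↔ (Sign × Sign × Σ (ℕ × ℕ) (S ∘ embed))
  sign-decomposition {S} S-irr S-abs S-nonzero = mk↔ₛ′ to from to∘from from∘to
    where
    to : Σ (ℤ × ℤ) S → Sign × Sign × Σ (ℕ × ℕ) (S ∘ embed)
    to ((x , y) , s) = sign x , sign y , abs (x , y) , S-abs (x , y) (embed (abs (x , y))) refl s
    from : Sign × Sign × Σ (ℕ × ℕ) (S ∘ embed) → Σ (ℤ × ℤ) S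
    from (σ , τ , (a , b) , s) =
      (σ ◃ a , τ ◃ b) ,
      S-abs (embed (a , b)) (σ ◃ a , τ ◃ b) (sym (cong₂ _,_ (abs-◃ σ a) (abs-◃ τ b))) s
    to∘from : ∀ w → to (from w) ≡ w
    to∘from (σ , τ , (a , b) , s) =
      cong₂ _,_ (sign-◃ σ a {{proj₁ (S-nonzero a b s)}})
        (cong₂ _,_ (sign-◃ τ b {{proj₂ (S-nonzero a b s)}})
                   (Σ-≡-irrelevant (S-irr ∘ embed) (cong₂ _,_ (abs-◃ σ a) (abs-◃ τ b))))
    from∘to : ∀ z → from (to z) ≡ z
    from∘to ((x , y) , s) = Σ-≡-irrelevant S-irr (cong₂ _,_ (◃-inverse x) (◃-inverse y))

  signs×-↔ : ∀ {c} {A : Set} → Fin c ↔ A → Fin (2 * (2 * c)) ↔ (Sign × Sign × A)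
  signs×-↔ e = (2↔Sign ×-↔ (2↔Sign ×-↔ e)) ↔-∘ ((↔-refl ×-↔ *↔×) ↔-∘ *↔×)

module Residues where

  open import Data.Nat as ℕ using (ℕ; _+_; _*_; _%_; NonZero)
  import Data.Nat.Properties as ℕP
  open import Data.Nat.DivMod using (%-distribˡ-+; %-distribˡ-*; m%n<n; m∣n⇒o%n%m≡o%m; m%n*o≡m*o%[n*o])
  import Data.Nat.Divisibility as ℕ∣
  open import Data.Nat.Coprimality using (Coprime)
  open import Data.Fin using (Fin; toℕ; fromℕ<)
  open import Data.Fin.Properties using (all?; toℕ-fromℕ<)
  open import Data.Product using (_×_; _,_; proj₁; proj₂)
  open import Relation.Nullary.Decidable using (toWitness; _×-dec_; _→-dec_; ¬?)
  open import Relation.Binary.PropositionalEquality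
  open ≡-Reasoning

  form : ℕ → ℕ → ℕ
  form a b = a * a + 216 * (b * b)

  form-% : ∀ a b n .{{_ : NonZero n}} → form a b % n ≡ form (a % n) (b % n) % n
  form-% a b n = begin
    (a * a + 216 * (b * b)) % n
      ≡⟨ %-distribˡ-+ (a * a) (216 * (b * b)) n ⟩
    ((a * a) % n + (216 * (b * b)) % n) % n
      ≡⟨ cong₂ (λ s t → (s + t) % n) (square-% a) (*-cong-% 216 (square-% b)) ⟩
    ((a % n * (a % n)) % n + (216 * (b % n * (b % n))) % n) % n
      ≡⟨ %-distribˡ-+ (a % n * (a % n)) (216 * (b % n * (b % n))) n ⟨
    (a % n * (a % n) + 216 * (b % n * (b % n))) % n ∎
    where
    square-% : ∀ c → (c * c) % n ≡ (c % n * (c % n)) % n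
    square-% c = %-distribˡ-* c c n
    *-cong-% : ∀ k {c d} → c % n ≡ d % n → (k * c) % n ≡ (k * d) % n
    *-cong-% k {c} {d} eq =
      trans (%-distribˡ-* k c n) (trans (cong (λ t → (k % n * t) % n) eq) (sym (%-distribˡ-* k d n)))

  on-residues : ∀ n .{{_ : NonZero n}} (R : ℕ → ℕ → Set) → (∀ (r s : Fin n) → R (toℕ r) (toℕ s)) →
                ∀ a b → R (a % n) (b % n)
  on-residues n R table a b = subst₂ R (toℕ-fromℕ< (m%n<n a n)) (toℕ-fromℕ< (m%n<n b n))
                                       (table (fromℕ< (m%n<n a n)) (fromℕ< (m%n<n b n)))

  form≡4-mod-16⇒even : ∀ a b → form a b % 16 ≡ 4 → 2 ℕ∣.∣ a × 2 ℕ∣.∣ b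
  form≡4-mod-16⇒even a b form≡4 = even a (proj₁ residues-even) , even b (proj₂ residues-even)
    where
    R : ℕ → ℕ → Set
    R r s = form r s % 16 ≡ 4 → r % 2 ≡ 0 × s % 2 ≡ 0
    table : ∀ (r s : Fin 16) → R (toℕ r) (toℕ s)
    table = toWitness {a? = all? λ r → all? λ s →
      (form (toℕ r) (toℕ s) % 16 ℕ.≟ 4) →-dec ((toℕ r % 2 ℕ.≟ 0) ×-dec (toℕ s % 2 ℕ.≟ 0))} _
    residues-even = on-residues 16 R table a b (trans (sym (form-% a b 16)) form≡4)
    even : ∀ c → c % 16 % 2 ≡ 0 → 2 ℕ∣.∣ c
    even c eq = ℕ∣.m%n≡0⇒n∣m c 2 (trans (sym (m∣n⇒o%n%m≡o%m 2 16 c (ℕ∣.divides 8 refl))) eq)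

  form≢2-mod-3 : ∀ a b → form a b % 3 ≢ 2
  form≢2-mod-3 a b form≡2 = on-residues 3 R table a b (trans (sym (form-% a b 3)) form≡2)
    where
    R : ℕ → ℕ → Set
    R r s = form r s % 3 ≢ 2
    table : ∀ (r s : Fin 3) → R (toℕ r) (toℕ s)
    table = toWitness {a? = all? λ r → all? λ s → ¬? (form (toℕ r) (toℕ s) % 3 ℕ.≟ 2)} _

  4*p%16≡4 : ∀ p → p % 24 ≡ 1 → (4 * p) % 16 ≡ 4
  4*p%16≡4 p p%24≡1 = begin
    (4 * p) % 16        ≡⟨ cong (_% 16) (ℕP.*-comm 4 p) ⟩
    (p * 4) % (4 * 4)   ≡⟨ m%n*o≡m*o%[n*o] p 4 4 ⟨
    p % 4 * 4           ≡⟨ cong (_* 4) p%4≡1 ⟩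
    4                   ∎
    where p%4≡1 = trans (sym (m∣n⇒o%n%m≡o%m 4 24 p (ℕ∣.divides 6 refl))) (cong (_% 4) p%24≡1)

  8*p%3≡2 : ∀ p → p % 24 ≡ 1 → (8 * p) % 3 ≡ 2
  8*p%3≡2 p p%24≡1 = begin
    (8 * p) % 3             ≡⟨ %-distribˡ-* 8 p 3 ⟩
    (8 % 3 * (p % 3)) % 3   ≡⟨ cong (λ r → (2 * r) % 3) p%3≡1 ⟩
    2                       ∎
    where p%3≡1 = trans (sym (m∣n⇒o%n%m≡o%m 3 24 p (ℕ∣.divides 8 refl))) (cong (_% 3) p%24≡1)

  %≡1⇒coprime : ∀ n d .{{_ : NonZero d}} → n % d ≡ 1 → Coprime n d
  %≡1⇒coprime n d n%d≡1 {c} (c∣n , c∣d) =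
    ℕ∣.∣1⇒≡1 (subst (c ℕ∣.∣_) n%d≡1 (ℕ∣.%-presˡ-∣ c∣n c∣d))

  *%24≡1⇒coprime-6 : ∀ a b → (a * b) % 24 ≡ 1 → Coprime a 6 × Coprime b 6
  *%24≡1⇒coprime-6 a b ab%24≡1 =
    (λ (d∣a , d∣6) → ab⊥24 (ℕ∣.∣m⇒∣m*n b d∣a , ℕ∣.∣-trans d∣6 6∣24)) ,
    (λ (d∣b , d∣6) → ab⊥24 (ℕ∣.∣n⇒∣m*n a d∣b , ℕ∣.∣-trans d∣6 6∣24))
    where
    ab⊥24 = %≡1⇒coprime (a * b) 24 ab%24≡1
    6∣24 = ℕ∣.divides 4 refl

open import Defs
import Data.Nat as ℕ
open ℕ using (ℕ; zero; suc; z≤n)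
import Data.Nat.Divisibility as ℕ∣
import Data.Nat.Properties as ℕP
import Data.Nat.GCD as ℕGCD
open import Data.Nat.Coprimality as Coprimality using (Coprime; coprime-divisor; gcd≡1⇒coprime)
open import Data.Nat.Primality
  using (Prime; euclidsLemma; prime⇒nonZero; prime⇒irreducible; ¬prime[1]; prime[2])
open import Data.Integer.Base as ℤ using (ℤ; +_; -[1+_]; _+_; _*_; _-_; -_; 0ℤ; 1ℤ; -1ℤ)
import Data.Integer.Properties as ℤP
open import Data.Integer.GCD using (gcd)
open import Data.Integer.Divisibility.Signed
  using (_∣_; divides; ∣⇒∣ᵤ; ∣ᵤ⇒∣; ∣-refl; ∣m⇒∣m*n; ∣n⇒∣m*n; ∣m⇒∣-m;
         ∣m∣n⇒∣m+n; ∣m∣n⇒∣m-n; ∣m+n∣n⇒∣m; ∣m+n∣m⇒∣n)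
open import Data.Integer.Tactic.RingSolver using (solve-∀)
open import Data.Sign.Base using (Sign)
open import Data.Fin using (Fin)
open import Data.Empty using (⊥)
open import Data.Product using (Σ; ∃; _×_; _,_; proj₁; proj₂)
open import Data.Sum using (_⊎_; inj₁; inj₂; [_,_]′)
open import Function using (_∘_; id)
open import Function.Bundles using (_↔_)
open import Function.Construct.Composition using (_↔-∘_)
open import Function.Construct.Symmetry using (↔-sym)
open import Axiom.UniquenessOfIdentityProofs using (module Decidable⇒UIP)
open import Relation.Nullary using (¬_; contradiction; Irrelevant)
open import Relation.Nullary.Decidable using (_×-dec_)
open import Relation.Unary using (Decidable)
open import Relation.Binary.PropositionalEquality
open ≡-Reasoning

open Cardinality
open Signs
open Residues

prime∣*⇒∣⊎∣ : ∀ {q} → Prime q → ∀ x y → + q ∣ x * y → + q ∣ x ⊎ + q ∣ y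
prime∣*⇒∣⊎∣ {q} q-prime x y q∣xy
  with euclidsLemma ℤ.∣ x ∣ ℤ.∣ y ∣ q-prime (subst (q ℕ∣.∣_) (ℤP.abs-* x y) (∣⇒∣ᵤ q∣xy))
... | inj₁ q∣x = inj₁ (∣ᵤ⇒∣ q∣x)
... | inj₂ q∣y = inj₂ (∣ᵤ⇒∣ q∣y)

prime∣square⇒∣ : ∀ {q} → Prime q → ∀ x → + q ∣ x * x → + q ∣ x
prime∣square⇒∣ q-prime x q∣xx = [ id , id ]′ (prime∣*⇒∣⊎∣ q-prime x x q∣xx)

module _ {q : ℕ} (q-prime : Prime q) {k x y : ℤ} (q∣form : + q ∣ x * x + k * (y * y)) where

  ∣form∧∣ky²⇒∣x : + q ∣ k * (y * y) → + q ∣ x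
  ∣form∧∣ky²⇒∣x q∣kyy = prime∣square⇒∣ q-prime x (∣m+n∣n⇒∣m q∣form q∣kyy)

  ∣form∧∣x⇒∣y : ¬ + q ∣ k → + q ∣ x → + q ∣ y
  ∣form∧∣x⇒∣y q∤k q∣x
    with prime∣*⇒∣⊎∣ q-prime k (y * y) (∣m+n∣m⇒∣n q∣form (∣m⇒∣m*n x q∣x))
  ... | inj₁ q∣k  = contradiction q∣k q∤k
  ... | inj₂ q∣yy = prime∣square⇒∣ q-prime y q∣yy

-- (x , y) stands for x + y√-216 ∈ ℤ[√-216]: _·_ is its multiplication and _⊙_ multiplication by an integer.

infixl 7 _·_
infixr 8 _⊙_

norm : ℤ × ℤ → ℤ
norm (x , y) = Q x y

_·_ : ℤ × ℤ → ℤ × ℤ → ℤ × ℤ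
(x , y) · (u , v) = x * u - + 216 * (y * v) , x * v + y * u

conj : ℤ × ℤ → ℤ × ℤ
conj (x , y) = x , - y

_⊙_ : ℤ → ℤ × ℤ → ℤ × ℤ
k ⊙ (x , y) = k * x , k * y

norm-· : ∀ z w → norm (z · w) ≡ norm z * norm w
norm-· (x , y) (u , v) = identity x y u v
  where
  identity : ∀ x y u v →
    (x * u - + 216 * (y * v)) * (x * u - + 216 * (y * v)) + + 216 * ((x * v + y * u) * (x * v + y * u))
    ≡ (x * x + + 216 * (y * y)) * (u * u + + 216 * (v * v))
  identity = solve-∀

norm-⊙ : ∀ k z → norm (k ⊙ z) ≡ k * k * norm z
norm-⊙ k (x , y) = identity k x y
  where
  identity : ∀ k x y → k * x * (k * x) + + 216 * (k * y * (k * y)) ≡ k * k * (x * x + + 216 * (y * y))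
  identity = solve-∀

norm-conj : ∀ z → norm (conj z) ≡ norm z
norm-conj (x , y) = cong (λ t → x * x + + 216 * t) (identity y)
  where
  identity : ∀ y → - y * - y ≡ y * y
  identity = solve-∀

1⊙ : ∀ v → 1ℤ ⊙ v ≡ v
1⊙ (x , y) = cong₂ _,_ (ℤP.*-identityˡ x) (ℤP.*-identityˡ y)

⊙-⊙ : ∀ k l z → k ⊙ l ⊙ z ≡ (k * l) ⊙ z
⊙-⊙ k l (x , y) = cong₂ _,_ (sym (ℤP.*-assoc k l x)) (sym (ℤP.*-assoc k l y))

⊙-· : ∀ k z w → k ⊙ z · w ≡ k ⊙ (z · w)
⊙-· k (x , y) (u , v) = cong₂ _,_ (re k x y u v) (im k x y u v)
  where
  re : ∀ k x y u v → k * x * u - + 216 * (k * y * v) ≡ k * (x * u - + 216 * (y * v))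
  re = solve-∀
  im : ∀ k x y u v → k * x * v + k * y * u ≡ k * (x * v + y * u)
  im = solve-∀

·-⊙ : ∀ k z w → z · k ⊙ w ≡ k ⊙ (z · w)
·-⊙ k (x , y) (u , v) = cong₂ _,_ (re k x y u v) (im k x y u v)
  where
  re : ∀ k x y u v → x * (k * u) - + 216 * (y * (k * v)) ≡ k * (x * u - + 216 * (y * v))
  re = solve-∀
  im : ∀ k x y u v → x * (k * v) + y * (k * u) ≡ k * (x * v + y * u)
  im = solve-∀

conj-conj : ∀ z → conj (conj z) ≡ z
conj-conj (x , y) = cong (x ,_) (ℤP.neg-involutive y)

conj-⊙ : ∀ k z → conj (k ⊙ z) ≡ k ⊙ conj z
conj-⊙ k (x , y) = cong (k * x ,_) (ℤP.neg-distribʳ-* k y)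

conj-· : ∀ z w → conj (z · w) ≡ conj z · conj w
conj-· (x , y) (u , v) = cong₂ _,_ (re x y u v) (im x y u v)
  where
  re : ∀ x y u v → x * u - + 216 * (y * v) ≡ x * u - + 216 * (- y * - v)
  re = solve-∀
  im : ∀ x y u v → - (x * v + y * u) ≡ x * - v + - y * u
  im = solve-∀

·-·-conj : ∀ z w → z · w · conj w ≡ norm w ⊙ z
·-·-conj (x , y) (u , v) = cong₂ _,_ (re x y u v) (im x y u v)
  where
  re : ∀ x y u v →
    (x * u - + 216 * (y * v)) * u - + 216 * ((x * v + y * u) * - v) ≡ (u * u + + 216 * (v * v)) * x
  re = solve-∀
  im : ∀ x y u v → (x * u - + 216 * (y * v)) * - v + (x * v + y * u) * u ≡ (u * u + + 216 * (v * v)) * y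
  im = solve-∀

conj-·-· : ∀ z w → conj z · (z · w) ≡ norm z ⊙ w
conj-·-· (x , y) (u , v) = cong₂ _,_ (re x y u v) (im x y u v)
  where
  re : ∀ x y u v →
    x * (x * u - + 216 * (y * v)) - + 216 * (- y * (x * v + y * u)) ≡ (x * x + + 216 * (y * y)) * u
  re = solve-∀
  im : ∀ x y u v → x * (x * v + y * u) + - y * (x * u - + 216 * (y * v)) ≡ (x * x + + 216 * (y * y)) * v
  im = solve-∀

conj-·-cancel : ∀ {k z w z′} → z · w ≡ k ⊙ z′ → k ⊙ (conj z · z′) ≡ norm z ⊙ w
conj-·-cancel {k} {z} {w} {z′} eq = begin
  k ⊙ (conj z · z′)   ≡⟨ ·-⊙ k (conj z) z′ ⟨
  conj z · k ⊙ z′     ≡⟨ cong (conj z ·_) eq ⟨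
  conj z · (z · w)    ≡⟨ conj-·-· z w ⟩
  norm z ⊙ w          ∎

im-conj-·-self : ∀ z → proj₂ (conj z · z) ≡ 0ℤ
im-conj-·-self (x , y) = identity x y
  where
  identity : ∀ x y → x * y + - y * x ≡ + 0
  identity = solve-∀

im-square : ∀ x y → proj₂ ((x , y) · (x , y)) ≡ + 2 * (x * y)
im-square = identity
  where
  identity : ∀ x y → x * y + y * x ≡ + 2 * (x * y)
  identity = solve-∀

re-·-conj-sum : ∀ z w → proj₁ (z · w) + proj₁ (z · conj w) ≡ + 2 * (proj₁ z * proj₁ w)
re-·-conj-sum (x , y) (u , v) = identity x y u v
  where
  identity : ∀ x y u v → x * u - + 216 * (y * v) + (x * u - + 216 * (y * - v)) ≡ + 2 * (x * u)
  identity = solve-∀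

re-·-conj-product : ∀ z w → proj₁ (z · w) * proj₁ (z · conj w)
                            ≡ norm z * (proj₁ w * proj₁ w) - + 216 * (proj₂ z * proj₂ z) * norm w
re-·-conj-product (x , y) (u , v) = identity x y u v
  where
  identity : ∀ x y u v → (x * u - + 216 * (y * v)) * (x * u - + 216 * (y * - v))
                         ≡ (x * x + + 216 * (y * y)) * (u * u) - + 216 * (y * y) * (u * u + + 216 * (v * v))
  identity = solve-∀

im-·-conj-product : ∀ z w → + 216 * (proj₂ (z · w) * proj₂ (z · conj w))
                            ≡ proj₁ w * proj₁ w * norm z - proj₁ z * proj₁ z * norm w
im-·-conj-product (x , y) (u , v) = identity x y u v
  where
  identity : ∀ x y u v → + 216 * ((x * v + y * u) * (x * - v + y * u))
                         ≡ u * u * (x * x + + 216 * (y * y)) - x * x * (u * u + + 216 * (v * v))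
  identity = solve-∀

∣-components⇒⊙ : ∀ {k v} → k ∣ proj₁ v → k ∣ proj₂ v → ∃ λ v′ → v ≡ k ⊙ v′
∣-components⇒⊙ {k} (divides q₁ eq₁) (divides q₂ eq₂) =
  (q₁ , q₂) , cong₂ _,_ (trans eq₁ (ℤP.*-comm q₁ k)) (trans eq₂ (ℤP.*-comm q₂ k))

∣-· : ∀ {d a b} → d ∣ proj₁ a → d ∣ proj₂ a → d ∣ proj₁ (a · b) × d ∣ proj₂ (a · b)
∣-· {d} {a₁ , a₂} {b₁ , b₂} d∣a₁ d∣a₂ =
  ∣m∣n⇒∣m-n (∣m⇒∣m*n b₁ d∣a₁) (∣n⇒∣m*n (+ 216) (∣m⇒∣m*n b₂ d∣a₂)) ,
  ∣m∣n⇒∣m+n (∣m⇒∣m*n b₂ d∣a₁) (∣m⇒∣m*n b₁ d∣a₂)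

Unit : ℤ → Set
Unit ε = ε ≡ 1ℤ ⊎ ε ≡ -1ℤ

unit-∣ : ∀ {k ε t} → Unit ε → k ∣ ε * t → k ∣ t
unit-∣ {t = t} (inj₁ refl) k∣εt = subst (_ ∣_) (ℤP.*-identityˡ t) k∣εt
unit-∣ {t = t} (inj₂ refl) k∣εt =
  subst (_ ∣_) (trans (cong -_ (ℤP.-1*i≡-i t)) (ℤP.neg-involutive t)) (∣m⇒∣-m k∣εt)

abs-unit-⊙ : ∀ {ε} → Unit ε → ∀ z → abs (ε ⊙ z) ≡ abs z
abs-unit-⊙ (inj₁ refl) z = cong abs (1⊙ z)
abs-unit-⊙ (inj₂ refl) (x , y) = cong₂ _,_ (∣-1*i∣≡∣i∣ x) (∣-1*i∣≡∣i∣ y)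
  where
  ∣-1*i∣≡∣i∣ : ∀ i → ℤ.∣ -1ℤ * i ∣ ≡ ℤ.∣ i ∣
  ∣-1*i∣≡∣i∣ i = trans (cong ℤ.∣_∣ (ℤP.-1*i≡-i i)) (ℤP.∣-i∣≡∣i∣ i)

abs-conj : ∀ z → abs (conj z) ≡ abs z
abs-conj (x , y) = cong (ℤ.∣ x ∣ ,_) (ℤP.∣-i∣≡∣i∣ y)

∣∣≡⇒≡⊎≡- : ∀ i j → ℤ.∣ i ∣ ≡ ℤ.∣ j ∣ → i ≡ j ⊎ i ≡ - j
∣∣≡⇒≡⊎≡- (+ m)    (+ n)    eq   = inj₁ (cong +_ eq)
∣∣≡⇒≡⊎≡- (+ m)    -[1+ n ] eq   = inj₂ (cong +_ eq)
∣∣≡⇒≡⊎≡- -[1+ m ] (+ n)    eq   = inj₂ (cong (λ k → - (+ k)) eq)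
∣∣≡⇒≡⊎≡- -[1+ m ] -[1+ n ] refl = inj₁ refl

same-abs : ∀ z′ z → abs z′ ≡ abs z → ∃ λ ε → Unit ε × (z′ ≡ ε ⊙ z ⊎ z′ ≡ ε ⊙ conj z)
same-abs (x′ , y′) (x , y) eq
  with ∣∣≡⇒≡⊎≡- x′ x (cong proj₁ eq) | ∣∣≡⇒≡⊎≡- y′ y (cong proj₂ eq)
... | inj₁ refl | inj₁ refl = 1ℤ , inj₁ refl , inj₁ (sym (1⊙ (x , y)))
... | inj₁ refl | inj₂ refl = 1ℤ , inj₁ refl , inj₂ (sym (1⊙ (x , - y)))
... | inj₂ refl | inj₂ refl = -1ℤ , inj₂ refl , inj₁ (sym (cong₂ _,_ (ℤP.-1*i≡-i x) (ℤP.-1*i≡-i y)))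
... | inj₂ refl | inj₁ refl = -1ℤ , inj₂ refl ,
  inj₂ (sym (cong₂ _,_ (ℤP.-1*i≡-i x) (trans (ℤP.-1*i≡-i (- y)) (ℤP.neg-involutive y))))

square-abs : ∀ i → i * i ≡ + ℤ.∣ i ∣ * + ℤ.∣ i ∣
square-abs (+ n)    = refl
square-abs -[1+ n ] = refl

norm-abs : ∀ {z z′} → abs z ≡ abs z′ → norm z ≡ norm z′
norm-abs {x , y} {x′ , y′} eq = begin
  x * x + + 216 * (y * y)
    ≡⟨ cong₂ (λ a b → a + + 216 * b) (square-abs x) (square-abs y) ⟩
  + ℤ.∣ x ∣ * + ℤ.∣ x ∣ + + 216 * (+ ℤ.∣ y ∣ * + ℤ.∣ y ∣)
    ≡⟨ cong (λ (a , b) → + a * + a + + 216 * (+ b * + b)) eq ⟩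
  + ℤ.∣ x′ ∣ * + ℤ.∣ x′ ∣ + + 216 * (+ ℤ.∣ y′ ∣ * + ℤ.∣ y′ ∣)
    ≡⟨ cong₂ (λ a b → a + + 216 * b) (square-abs x′) (square-abs y′) ⟨
  x′ * x′ + + 216 * (y′ * y′) ∎

PrimSol-abs : ∀ {N z z′} → abs z ≡ abs z′ → PrimSol N z → PrimSol N z′
PrimSol-abs {z = z} {z′} eq (norm≡N , gcd≡1) =
  trans (sym (norm-abs {z} {z′} eq)) norm≡N , trans (cong (λ (a , b) → + ℕGCD.gcd a b) (sym eq)) gcd≡1

PrimSol-irrelevant : ∀ N z → Irrelevant (PrimSol N z)
PrimSol-irrelevant _ _ (e₁ , g₁) (e₂ , g₂) = cong₂ _,_ (≡-irrelevant e₁ e₂) (≡-irrelevant g₁ g₂)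
  where open Decidable⇒UIP ℤP._≟_

PrimSol? : ∀ {N} → Decidable (PrimSol N)
PrimSol? (x , y) = (Q x y ℤP.≟ _) ×-dec (gcd x y ℤP.≟ + 1)

norm-embed : ∀ a b → norm (embed (a , b)) ≡ + form a b
norm-embed a b = sym (begin
  + (a ℕ.* a ℕ.+ 216 ℕ.* (b ℕ.* b))     ≡⟨ ℤP.pos-+ (a ℕ.* a) (216 ℕ.* (b ℕ.* b)) ⟩
  + (a ℕ.* a) + + (216 ℕ.* (b ℕ.* b))   ≡⟨ cong₂ _+_ (ℤP.pos-* a a) (ℤP.pos-* 216 (b ℕ.* b)) ⟩
  + a * + a + + 216 * + (b ℕ.* b)       ≡⟨ cong (λ t → + a * + a + + 216 * t) (ℤP.pos-* b b) ⟩
  + a * + a + + 216 * (+ b * + b)       ∎)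

form-abs : ∀ z {k} → norm z ≡ + k → form ℤ.∣ proj₁ z ∣ ℤ.∣ proj₂ z ∣ ≡ k
form-abs z {k} norm≡k = ℤP.+-injective (begin
  + form (proj₁ (abs z)) (proj₂ (abs z))   ≡⟨ norm-embed (proj₁ (abs z)) (proj₂ (abs z)) ⟨
  norm (embed (abs z))                     ≡⟨ norm-abs {embed (abs z)} {z} refl ⟩
  norm z                                   ≡⟨ norm≡k ⟩
  + k                                      ∎)

PrimSol-bounded : ∀ {n a b} → PrimSol (+ n) (embed (a , b)) → a ℕ.< suc n × b ℕ.< suc n
PrimSol-bounded {n} {a} {b} (norm≡n , _) =
  ℕ.s≤s (ℕP.≤-trans (k≤k*k a) (ℕP.≤-trans (ℕP.m≤m+n (a ℕ.* a) (216 ℕ.* (b ℕ.* b))) form≤n)) ,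
  ℕ.s≤s (ℕP.≤-trans (k≤k*k b) (ℕP.≤-trans (ℕP.m≤n*m (b ℕ.* b) 216)
                               (ℕP.≤-trans (ℕP.m≤n+m (216 ℕ.* (b ℕ.* b)) (a ℕ.* a)) form≤n)))
  where
  form≤n : form a b ℕ.≤ n
  form≤n = ℕP.≤-reflexive (ℤP.+-injective (trans (sym (norm-embed a b)) norm≡n))
  k≤k*k : ∀ k → k ℕ.≤ k ℕ.* k
  k≤k*k zero    = z≤n
  k≤k*k (suc k) = ℕP.m≤m*n (suc k) (suc k)

finite-positive-PrimSol : ∀ n → Finite (Σ (ℕ × ℕ) (PrimSol (+ n) ∘ embed))
finite-positive-PrimSol n =
  finite-bounded-pairs (suc n) (PrimSol? ∘ embed) (PrimSol-irrelevant (+ n) ∘ embed) (PrimSol-bounded {n})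

primitive-⊙ : ∀ k z → gcd (proj₁ (k ⊙ z)) (proj₂ (k ⊙ z)) ≡ + 1 → gcd (proj₁ z) (proj₂ z) ≡ + 1
primitive-⊙ k (x , y) gcd≡1 = cong +_ (ℕ∣.∣1⇒≡1 (subst (g ℕ∣.∣_) (cong ℤ.∣_∣ gcd≡1)
  (ℕGCD.gcd-greatest (∣k* x (ℕGCD.gcd[m,n]∣m ℤ.∣ x ∣ ℤ.∣ y ∣))
                     (∣k* y (ℕGCD.gcd[m,n]∣n ℤ.∣ x ∣ ℤ.∣ y ∣)))))
  where
  g = ℕGCD.gcd ℤ.∣ x ∣ ℤ.∣ y ∣
  ∣k* : ∀ i → g ℕ∣.∣ ℤ.∣ i ∣ → g ℕ∣.∣ ℤ.∣ k * i ∣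
  ∣k* i g∣i = subst (g ℕ∣.∣_) (sym (ℤP.abs-* k i)) (ℕ∣.∣n⇒∣m*n ℤ.∣ k ∣ g∣i)

n∣im⇒im≡0 : ∀ n v → norm v ≡ + n * + n → + n ∣ proj₂ v → proj₂ v ≡ 0ℤ
n∣im⇒im≡0 n v norm≡n² n∣im =
  ℤP.∣i∣≡0⇒i≡0 (too-small {ℤ.∣ proj₁ v ∣} (form-abs v (trans norm≡n² (sym (ℤP.pos-* n n))))
                           (∣⇒∣ᵤ n∣im))
  where
  216*≤⇒≡0 : ∀ {k} → 216 ℕ.* k ℕ.≤ k → k ≡ 0
  216*≤⇒≡0 {k} 216k≤k
    with ℕP.m*n≡0⇒m≡0∨n≡0 215 (ℕP.n≤0⇒n≡0 (ℕP.+-cancelˡ-≤ k (215 ℕ.* k) 0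
           (ℕP.≤-trans 216k≤k (ℕP.≤-reflexive (sym (ℕP.+-identityʳ k))))))
  ... | inj₂ k≡0 = k≡0
  too-small : ∀ {a t} → form a t ≡ n ℕ.* n → n ℕ∣.∣ t → t ≡ 0
  too-small {t = zero}      _       _   = refl
  too-small {a} {t@(suc _)} form≡n² n∣t =
    contradiction (ℕ∣.0∣⇒≡0 (subst (ℕ∣._∣ t) n≡0 n∣t)) λ ()
    where
    n≡0 : n ≡ 0
    n≡0 = [ id , id ]′ (ℕP.m*n≡0⇒m≡0∨n≡0 n (216*≤⇒≡0 (ℕP.≤-trans
      (ℕP.*-monoʳ-≤ 216 (ℕP.*-mono-≤ (ℕ∣.∣⇒≤ n∣t) (ℕ∣.∣⇒≤ n∣t)))
      (ℕP.≤-trans (ℕP.m≤n+m (216 ℕ.* (t ℕ.* t)) (a ℕ.* a)) (ℕP.≤-reflexive form≡n²)))))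

coprime-*ʳ : ∀ {a b c} → Coprime a b → Coprime a c → Coprime a (b ℕ.* c)
coprime-*ʳ {a} {b} {c} a⊥b a⊥c {d} (d∣a , d∣bc) = a⊥c (d∣a , coprime-divisor d⊥b d∣bc)
  where
  d⊥b : Coprime d b
  d⊥b (e∣d , e∣b) = a⊥b (ℕ∣.∣-trans e∣d d∣a , e∣b)

coprime-squares : ∀ {a b} → Coprime a b → Coprime (a ℕ.* a) (b ℕ.* b)
coprime-squares a⊥b = Coprimality.sym (coprime-*ʳ b*b⊥a b*b⊥a)
  where b*b⊥a = Coprimality.sym (coprime-*ʳ a⊥b a⊥b)

cross-coprime⇒≡ : ∀ {a b c d} → Coprime a b → Coprime c d → a ℕ.* d ≡ b ℕ.* c → a ≡ c × b ≡ d
cross-coprime⇒≡ {a} {b} {c} {d} a⊥b c⊥d ad≡bc =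
  ℕ∣.∣-antisym (coprime-divisor a⊥b (ℕ∣.divides d (trans (sym ad≡bc) (ℕP.*-comm a d))))
               (coprime-divisor c⊥d (ℕ∣.divides b (trans (ℕP.*-comm d a) ad≡bc))) ,
  ℕ∣.∣-antisym (coprime-divisor (Coprimality.sym a⊥b) (ℕ∣.divides c (trans ad≡bc (ℕP.*-comm b c))))
               (coprime-divisor (Coprimality.sym c⊥d) (ℕ∣.divides a (trans (ℕP.*-comm c b) (sym ad≡bc))))

m∣x²±216y²⇒m≡1 : ∀ {m x y} → Coprime m 6 → gcd x y ≡ + 1 →
                 + m ∣ x * x + + 216 * (y * y) → + m ∣ x * x - + 216 * (y * y) → m ≡ 1
m∣x²±216y²⇒m≡1 {m} {x} {y} m⊥6 gcd≡1 m∣sum m∣difference =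
  coprime-squares {ℤ.∣ x ∣} {ℤ.∣ y ∣} (gcd≡1⇒coprime (cong ℤ.∣_∣ gcd≡1)) (m∣x² , m∣y²)
  where
  m⊥2 : Coprime m 2
  m⊥2 (d∣m , d∣2) = m⊥6 (d∣m , ℕ∣.∣-trans d∣2 (ℕ∣.divides 3 refl))
  2x²≡sum+difference : ∀ x y → + 2 * (x * x) ≡ (x * x + + 216 * (y * y)) + (x * x - + 216 * (y * y))
  2x²≡sum+difference = solve-∀
  432y²≡sum-difference : ∀ x y → + 432 * (y * y) ≡ (x * x + + 216 * (y * y)) - (x * x - + 216 * (y * y))
  432y²≡sum-difference = solve-∀
  ∣k*square∣ : ∀ k i → ℤ.∣ + k * (i * i) ∣ ≡ k ℕ.* (ℤ.∣ i ∣ ℕ.* ℤ.∣ i ∣)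
  ∣k*square∣ k i = trans (ℤP.abs-* (+ k) (i * i)) (cong (k ℕ.*_) (ℤP.abs-* i i))
  m∣x² : m ℕ∣.∣ ℤ.∣ x ∣ ℕ.* ℤ.∣ x ∣
  m∣x² = coprime-divisor m⊥2 (subst (m ℕ∣.∣_) (∣k*square∣ 2 x)
    (∣⇒∣ᵤ (subst (+ m ∣_) (sym (2x²≡sum+difference x y)) (∣m∣n⇒∣m+n m∣sum m∣difference))))
  m⊥432 : Coprime m 432
  m⊥432 = coprime-*ʳ m⊥6 (coprime-*ʳ m⊥6 (coprime-*ʳ m⊥6 m⊥2))
  m∣y² : m ℕ∣.∣ ℤ.∣ y ∣ ℕ.* ℤ.∣ y ∣
  m∣y² = coprime-divisor m⊥432 (subst (m ℕ∣.∣_) (∣k*square∣ 432 y)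
    (∣⇒∣ᵤ (subst (+ m ∣_) (sym (432y²≡sum-difference x y)) (∣m∣n⇒∣m-n m∣sum m∣difference))))

quarter-square : ∀ c y → (+ 4) ⊙ (c * c - + 54 * (y * y) , c * y) ≡ (c * + 2 , y) · (c * + 2 , y)
quarter-square c y = cong₂ _,_ (re c y) (im c y)
  where
  re : ∀ c y → + 4 * (c * c - + 54 * (y * y)) ≡ c * + 2 * (c * + 2) - + 216 * (y * y)
  re = solve-∀
  im : ∀ c y → + 4 * (c * y) ≡ c * + 2 * y + y * (c * + 2)
  im = solve-∀

eighth-square : ∀ e y → (+ 8) ⊙ (+ 2 * (e * e) - + 27 * (y * y) , e * y)
                        ≡ (e * + 2 * + 2 , y) · (e * + 2 * + 2 , y)
eighth-square e y = cong₂ _,_ (re e y) (im e y)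
  where
  re : ∀ e y → + 8 * (+ 2 * (e * e) - + 27 * (y * y)) ≡ e * + 2 * + 2 * (e * + 2 * + 2) - + 216 * (y * y)
  re = solve-∀
  im : ∀ e y → + 8 * (e * y) ≡ e * + 2 * + 2 * y + y * (e * + 2 * + 2)
  im = solve-∀

norm-twice : ∀ c y → norm (c * + 2 , y) ≡ + 4 * (c * c + + 54 * (y * y))
norm-twice = identity
  where
  identity : ∀ c y → c * + 2 * (c * + 2) + + 216 * (y * y) ≡ + 4 * (c * c + + 54 * (y * y))
  identity = solve-∀

2∣norm⇒2∣re : ∀ {x y} → + 2 ∣ norm (x , y) → + 2 ∣ x
2∣norm⇒2∣re {x} {y} 2∣norm =
  ∣form∧∣ky²⇒∣x prime[2] {+ 216} {x} {y} 2∣norm (∣m⇒∣m*n (y * y) (divides (+ 108) refl))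

square-divisible-4 : ∀ n z → norm z ≡ + (4 ℕ.* n) → ∃ λ w → (+ 4) ⊙ w ≡ z · z
square-divisible-4 n (x , y) norm≡4n =
  halve (2∣norm⇒2∣re {x} {y} (subst (+ 2 ∣_) (sym norm≡4n) 2∣4n))
  where
  2∣4n = ∣ᵤ⇒∣ (ℕ∣.∣m⇒∣m*n n (ℕ∣.divides 2 refl))
  halve : + 2 ∣ x → ∃ λ w → (+ 4) ⊙ w ≡ (x , y) · (x , y)
  halve (divides c x≡2c) = (c * c - + 54 * (y * y) , c * y) ,
    subst (λ t → (+ 4) ⊙ (c * c - + 54 * (y * y) , c * y) ≡ (t , y) · (t , y))
          (sym x≡2c) (quarter-square c y)

square-divisible-8 : ∀ n z → norm z ≡ + (8 ℕ.* n) → ∃ λ w → (+ 8) ⊙ w ≡ z · z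
square-divisible-8 n (x , y) norm≡8n =
  halve (2∣norm⇒2∣re {x} {y} (subst (+ 2 ∣_) (sym norm≡8n) 2∣8n))
  where
  2∣8n = ∣ᵤ⇒∣ (ℕ∣.∣m⇒∣m*n n (ℕ∣.divides 4 refl))
  halve : + 2 ∣ x → ∃ λ w → (+ 8) ⊙ w ≡ (x , y) · (x , y)
  halve (divides c x≡2c) =
    quarter (∣form∧∣ky²⇒∣x prime[2] {+ 54} {c} {y} 2∣half (∣m⇒∣m*n (y * y) (divides (+ 27) refl)))
    where
    half≡2n : c * c + + 54 * (y * y) ≡ + (2 ℕ.* n)
    half≡2n = ℤP.*-cancelˡ-≡ (+ 4) _ _ (begin
      + 4 * (c * c + + 54 * (y * y))   ≡⟨ norm-twice c y ⟨
      norm (c * + 2 , y)               ≡⟨ cong (λ t → norm (t , y)) x≡2c ⟨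
      norm (x , y)                     ≡⟨ norm≡8n ⟩
      + (8 ℕ.* n)                      ≡⟨ cong +_ (ℕP.*-assoc 4 2 n) ⟩
      + (4 ℕ.* (2 ℕ.* n))              ≡⟨ ℤP.pos-* 4 (2 ℕ.* n) ⟩
      + 4 * + (2 ℕ.* n)                ∎)
    2∣half : + 2 ∣ c * c + + 54 * (y * y)
    2∣half = subst (+ 2 ∣_) (sym half≡2n) (∣ᵤ⇒∣ (ℕ∣.m∣m*n n))
    quarter : + 2 ∣ c → ∃ λ w → (+ 8) ⊙ w ≡ (x , y) · (x , y)
    quarter (divides e c≡2e) = (+ 2 * (e * e) - + 27 * (y * y) , e * y) ,
      subst (λ t → (+ 8) ⊙ (+ 2 * (e * e) - + 27 * (y * y) , e * y) ≡ (t , y) · (t , y))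
            (sym (trans x≡2c (cong (_* + 2) c≡2e))) (eighth-square e y)

module AtPrime (p : ℕ) (p-prime : Prime p) (p∤6 : ¬ p ℕ∣.∣ 6) where

  P : ℤ
  P = + p

  instance
    P≢0 : ℤ.NonZero P
    P≢0 = prime⇒nonZero p-prime

  P∤216 : ¬ P ∣ + 216
  P∤216 P∣216 with euclidsLemma 6 36 p-prime (∣⇒∣ᵤ P∣216)
  ... | inj₁ p∣6 = p∤6 p∣6
  ... | inj₂ p∣36 with euclidsLemma 6 6 p-prime p∣36
  ...   | inj₁ p∣6 = p∤6 p∣6
  ...   | inj₂ p∣6 = p∤6 p∣6

  P∤2 : ¬ P ∣ + 2
  P∤2 P∣2 = p∤6 (ℕ∣.∣-trans (∣⇒∣ᵤ P∣2) (ℕ∣.divides 3 refl))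

  P∣0 : P ∣ 0ℤ
  P∣0 = divides 0ℤ refl

  P∣P*P : P ∣ P * P
  P∣P*P = ∣m⇒∣m*n P ∣-refl

  primitive⇒¬∣both : ∀ {x y} → gcd x y ≡ + 1 → ¬ (P ∣ x × P ∣ y)
  primitive⇒¬∣both gcd≡1 (P∣x , P∣y) = ¬prime[1] (subst Prime (ℕ∣.∣1⇒≡1 p∣1) p-prime)
    where
    p∣1 = subst (p ℕ∣.∣_) (cong ℤ.∣_∣ gcd≡1) (ℕGCD.gcd-greatest (∣⇒∣ᵤ P∣x) (∣⇒∣ᵤ P∣y))

  primitive⇒∤re : ∀ {x y} → P ∣ norm (x , y) → gcd x y ≡ + 1 → ¬ P ∣ x
  primitive⇒∤re {x} {y} P∣norm gcd≡1 P∣x =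
    primitive⇒¬∣both gcd≡1 (P∣x , ∣form∧∣x⇒∣y p-prime {+ 216} {x} {y} P∣norm P∤216 P∣x)

  primitive⇒∤im : ∀ {x y} → P ∣ norm (x , y) → gcd x y ≡ + 1 → ¬ P ∣ y
  primitive⇒∤im {x} {y} P∣norm gcd≡1 P∣y =
    primitive⇒¬∣both gcd≡1
      (∣form∧∣ky²⇒∣x p-prime {+ 216} {x} {y} P∣norm (∣n⇒∣m*n (+ 216) (∣m⇒∣m*n y P∣y)) , P∣y)

  primitive-nonzero : ∀ N a b → P ∣ N → PrimSol N (embed (a , b)) → ℕ.NonZero a × ℕ.NonZero b
  primitive-nonzero N a b P∣N (norm≡N , gcd≡1) = ℕ.≢-nonZero a≢0 , ℕ.≢-nonZero b≢0
    where
    P∣norm = subst (P ∣_) (sym norm≡N) P∣N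
    a≢0 : a ≢ 0
    a≢0 a≡0 = primitive⇒∤re {+ a} {+ b} P∣norm gcd≡1 (subst (λ k → P ∣ + k) (sym a≡0) P∣0)
    b≢0 : b ≢ 0
    b≢0 b≡0 = primitive⇒∤im {+ a} {+ b} P∣norm gcd≡1 (subst (λ k → P ∣ + k) (sym b≡0) P∣0)

  solutions↔signs×positive : ∀ {N} → P ∣ N →
                             Σ (ℤ × ℤ) (PrimSol N) ↔ (Sign × Sign × Σ (ℕ × ℕ) (PrimSol N ∘ embed))
  solutions↔signs×positive {N} P∣N = sign-decomposition (PrimSol-irrelevant N)
    (λ z z′ → PrimSol-abs {z = z} {z′}) (λ a b → primitive-nonzero N a b P∣N)

  twist-from-square : ∀ k z w .{{_ : ℤ.NonZero k}} → k ⊙ w ≡ z · z → norm z ≡ k * P →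
                      gcd (proj₁ z) (proj₂ z) ≡ + 1 → norm w ≡ P * P × ¬ P ∣ proj₂ w
  twist-from-square k z@(x , y) w kw≡z² norm≡kP gcd≡1 = norm-w , P∤im-w
    where
    interchange : ∀ k P → k * P * (k * P) ≡ k * k * (P * P)
    interchange = solve-∀
    norm-w : norm w ≡ P * P
    norm-w = ℤP.*-cancelˡ-≡ (k * k) (norm w) (P * P) {{ℤP.i*j≢0 k k}} (begin
      k * k * norm w      ≡⟨ norm-⊙ k w ⟨
      norm (k ⊙ w)        ≡⟨ cong norm kw≡z² ⟩
      norm (z · z)        ≡⟨ norm-· z z ⟩
      norm z * norm z     ≡⟨ cong₂ _*_ norm≡kP norm≡kP ⟩
      k * P * (k * P)     ≡⟨ interchange k P ⟩
      k * k * (P * P)     ∎)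
    P∣norm : P ∣ norm z
    P∣norm = subst (P ∣_) (sym norm≡kP) (∣n⇒∣m*n k ∣-refl)
    P∤x∧P∤y : ¬ P ∣ x * y
    P∤x∧P∤y = [ primitive⇒∤re {x} {y} P∣norm gcd≡1 , primitive⇒∤im {x} {y} P∣norm gcd≡1 ]′
              ∘ prime∣*⇒∣⊎∣ p-prime x y
    P∤im-w : ¬ P ∣ proj₂ w
    P∤im-w P∣w₂ = [ P∤2 , P∤x∧P∤y ]′ (prime∣*⇒∣⊎∣ p-prime (+ 2) (x * y)
      (subst (P ∣_) (trans (cong proj₂ kw≡z²) (im-square x y)) (∣n⇒∣m*n k P∣w₂)))

  𝒫⇒twist : InP p → ∃ λ w → norm w ≡ P * P × ¬ P ∣ proj₂ w
  𝒫⇒twist (_ , _ , inj₁ refl , z , norm≡p , gcd≡1) =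
    z · z , twist-from-square 1ℤ z (z · z) (1⊙ (z · z)) (trans norm≡p (ℤP.pos-* 1 p)) gcd≡1
  𝒫⇒twist (_ , _ , inj₂ (inj₁ refl) , z , norm≡4p , gcd≡1) =
    proj₁ w , twist-from-square (+ 4) z (proj₁ w) (proj₂ w) (trans norm≡4p (ℤP.pos-* 4 p)) gcd≡1
    where w = square-divisible-4 p z norm≡4p
  𝒫⇒twist (_ , _ , inj₂ (inj₂ refl) , z , norm≡8p , gcd≡1) =
    proj₁ w , twist-from-square (+ 8) z (proj₁ w) (proj₂ w) (trans norm≡8p (ℤP.pos-* 8 p)) gcd≡1
    where w = square-divisible-8 p z norm≡8p

  module _ (p%24≡1 : p ℕ.% 24 ≡ 1) where

    positive-solution : InP p → Σ (ℕ × ℕ) (PrimSol P ∘ embed)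
    positive-solution (_ , _ , inj₁ refl , z , norm≡p , gcd≡1) =
      abs z , PrimSol-abs {z = z} {embed (abs z)} refl (trans norm≡p (cong +_ (ℕP.*-identityˡ p)) , gcd≡1)
    positive-solution (_ , _ , inj₂ (inj₁ refl) , z , norm≡4p , gcd≡1) =
      halve (∣-components⇒⊙ {+ 2} {z} (∣ᵤ⇒∣ (proj₁ evens)) (∣ᵤ⇒∣ (proj₂ evens)))
      where
      evens = form≡4-mod-16⇒even _ _ (trans (cong (ℕ._% 16) (form-abs z norm≡4p)) (4*p%16≡4 p p%24≡1))
      halve : (∃ λ z₀ → z ≡ (+ 2) ⊙ z₀) → Σ (ℕ × ℕ) (PrimSol P ∘ embed)
      halve (z₀ , z≡2z₀) = abs z₀ , PrimSol-abs {z = z₀} {embed (abs z₀)} refl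
        (norm-z₀ , primitive-⊙ (+ 2) z₀ (subst (λ v → gcd (proj₁ v) (proj₂ v) ≡ + 1) z≡2z₀ gcd≡1))
        where
        norm-z₀ : norm z₀ ≡ P
        norm-z₀ = ℤP.*-cancelˡ-≡ (+ 4) (norm z₀) P (begin
          + 4 * norm z₀       ≡⟨ norm-⊙ (+ 2) z₀ ⟨
          norm ((+ 2) ⊙ z₀)   ≡⟨ cong norm z≡2z₀ ⟨
          norm z              ≡⟨ norm≡4p ⟩
          + (4 ℕ.* p)         ≡⟨ ℤP.pos-* 4 p ⟩
          + 4 * P             ∎)
    positive-solution (_ , _ , inj₂ (inj₂ refl) , z , norm≡8p , _) =
      contradiction (trans (cong (ℕ._% 3) (form-abs z norm≡8p)) (8*p%3≡2 p p%24≡1))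
                    (form≢2-mod-3 ℤ.∣ proj₁ z ∣ ℤ.∣ proj₂ z ∣)

    -- p divides 216·Im(z₁z₂)·Im(z₁z̄₂) = c²·N(z₁) − a²·N(z₂), and both products have norm p².
    positive-unique : ∀ (u v : Σ (ℕ × ℕ) (PrimSol P ∘ embed)) → u ≡ v
    positive-unique ((a , b) , s₁@(norm₁≡P , gcd₁≡1)) ((c , d) , s₂@(norm₂≡P , gcd₂≡1)) =
      Σ-≡-irrelevant (PrimSol-irrelevant P ∘ embed)
        (by-cases (prime∣*⇒∣⊎∣ p-prime (proj₂ (z₁ · z₂)) (proj₂ (z₁ · conj z₂)) P∣im*im))
      where
      z₁ = embed (a , b)
      z₂ = embed (c , d)
      P∣216*im*im : P ∣ + 216 * (proj₂ (z₁ · z₂) * proj₂ (z₁ · conj z₂))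
      P∣216*im*im = subst (P ∣_) (sym (im-·-conj-product z₁ z₂))
        (∣m∣n⇒∣m-n (∣n⇒∣m*n (+ c * + c) (subst (P ∣_) (sym norm₁≡P) ∣-refl))
                   (∣n⇒∣m*n (+ a * + a) (subst (P ∣_) (sym norm₂≡P) ∣-refl)))
      P∣im*im : P ∣ proj₂ (z₁ · z₂) * proj₂ (z₁ · conj z₂)
      P∣im*im = [ (λ P∣216 → contradiction P∣216 P∤216) , id ]′
                  (prime∣*⇒∣⊎∣ p-prime (+ 216) _ P∣216*im*im)
      norm-z₁· : ∀ w₂ → norm w₂ ≡ P → norm (z₁ · w₂) ≡ P * P
      norm-z₁· w₂ norm≡P = trans (norm-· z₁ w₂) (cong₂ _*_ norm₁≡P norm≡P)
      im-z₁z₂ : + a * + d + + b * + c ≡ + (a ℕ.* d ℕ.+ b ℕ.* c)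
      im-z₁z₂ = sym (trans (ℤP.pos-+ (a ℕ.* d) (b ℕ.* c)) (cong₂ _+_ (ℤP.pos-* a d) (ℤP.pos-* b c)))
      im-z₁z̄₂ : ∀ A B C D → A * - D + B * C ≡ B * C - A * D
      im-z₁z̄₂ = solve-∀
      by-cases : P ∣ proj₂ (z₁ · z₂) ⊎ P ∣ proj₂ (z₁ · conj z₂) → (a , b) ≡ (c , d)
      by-cases (inj₁ P∣im) =
        contradiction ad≡0 (ℕ.≢-nonZero⁻¹ (a ℕ.* d) {{ℕP.m*n≢0 a d {{a≢0}} {{d≢0}}}})
        where
        a≢0 = proj₁ (primitive-nonzero P a b ∣-refl s₁)
        d≢0 = proj₂ (primitive-nonzero P c d ∣-refl s₂)
        ad≡0 : a ℕ.* d ≡ 0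
        ad≡0 = ℕP.m+n≡0⇒m≡0 (a ℕ.* d) (ℤP.+-injective
          (trans (sym im-z₁z₂) (n∣im⇒im≡0 p (z₁ · z₂) (norm-z₁· z₂ norm₂≡P) P∣im)))
      by-cases (inj₂ P∣im) = cong₂ _,_ (proj₁ ac-bd) (proj₂ ac-bd)
        where
        bc≡ad : + b * + c ≡ + a * + d
        bc≡ad = ℤP.i-j≡0⇒i≡j _ _ (trans (sym (im-z₁z̄₂ (+ a) (+ b) (+ c) (+ d)))
          (n∣im⇒im≡0 p (z₁ · conj z₂) (norm-z₁· (conj z₂) (trans (norm-conj z₂) norm₂≡P)) P∣im))
        ac-bd = cross-coprime⇒≡
          (gcd≡1⇒coprime (cong ℤ.∣_∣ gcd₁≡1)) (gcd≡1⇒coprime (cong ℤ.∣_∣ gcd₂≡1))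
          (ℤP.+-injective (trans (ℤP.pos-* a d) (trans (sym bc≡ad) (sym (ℤP.pos-* b c)))))

    positive-card≡1 : InP p → ∀ {c} → Fin c ↔ Σ (ℕ × ℕ) (PrimSol P ∘ embed) → c ≡ 1
    positive-card≡1 p∈𝒫 e = contractible⇒card≡1 e (positive-solution p∈𝒫) positive-unique

  module TwistMap (w : ℤ × ℤ) (norm-w : norm w ≡ P * P) (P∤im-w : ¬ P ∣ proj₂ w) where

    P∤re-w : ¬ P ∣ proj₁ w
    P∤re-w P∣u = P∤im-w (∣form∧∣x⇒∣y p-prime {+ 216} {proj₁ w} {proj₂ w}
                                      (subst (P ∣_) (sym norm-w) P∣P*P) P∤216 P∣u)

    Twist : ℤ × ℤ → Set
    Twist w′ = w′ ≡ w ⊎ w′ ≡ conj w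

    twist-norm : ∀ {w′} → Twist w′ → norm w′ ≡ P * P
    twist-norm (inj₁ refl) = norm-w
    twist-norm (inj₂ refl) = trans (norm-conj w) norm-w

    twist-re : ∀ {w′} → Twist w′ → proj₁ w′ ≡ proj₁ w
    twist-re (inj₁ refl) = refl
    twist-re (inj₂ refl) = refl

    twist-∤im : ∀ {w′} → Twist w′ → ¬ P ∣ proj₂ w′
    twist-∤im (inj₁ refl) = P∤im-w
    twist-∤im (inj₂ refl) P∣-v = P∤im-w (subst (P ∣_) (ℤP.neg-involutive _) (∣m⇒∣-m P∣-v))

    twist-conj : ∀ {w′} → Twist w′ → Twist (conj w′)
    twist-conj (inj₁ refl) = inj₂ refl
    twist-conj (inj₂ refl) = inj₁ (conj-conj w)

    infix 4 _↦_
    data _↦_ (z z′ : ℤ × ℤ) : Set where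
      via : ∀ {w′} → Twist w′ → z · w′ ≡ P ⊙ z′ → z ↦ z′

    ⊙-cancel : ∀ {a b} → P ⊙ a ≡ P ⊙ b → a ≡ b
    ⊙-cancel {a₁ , a₂} {b₁ , b₂} eq =
      cong₂ _,_ (ℤP.*-cancelˡ-≡ P a₁ b₁ (cong proj₁ eq))
                (ℤP.*-cancelˡ-≡ P a₂ b₂ (cong proj₂ eq))

    ⊙⇒∣re : ∀ {v v′} → v ≡ P ⊙ v′ → P ∣ proj₁ v
    ⊙⇒∣re {v′ = v₁ , _} refl = divides v₁ (ℤP.*-comm P v₁)

    ↦-norm : ∀ {z z′} → z ↦ z′ → norm z′ ≡ norm z
    ↦-norm {z} {z′} (via {w′} t eq) =
      ℤP.*-cancelˡ-≡ (P * P) (norm z′) (norm z) {{ℤP.i*j≢0 P P}} (begin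
      P * P * norm z′   ≡⟨ norm-⊙ P z′ ⟨
      norm (P ⊙ z′)     ≡⟨ cong norm eq ⟨
      norm (z · w′)     ≡⟨ norm-· z w′ ⟩
      norm z * norm w′  ≡⟨ cong (norm z *_) (twist-norm t) ⟩
      norm z * (P * P)  ≡⟨ ℤP.*-comm (norm z) (P * P) ⟩
      P * P * norm z    ∎)

    ↦-sym : ∀ {z z′} → z ↦ z′ → z′ ↦ z
    ↦-sym {z} {z′} (via {w′} t eq) = via (twist-conj t) (⊙-cancel (begin
      P ⊙ (z′ · conj w′)   ≡⟨ ⊙-· P z′ (conj w′) ⟨
      P ⊙ z′ · conj w′     ≡⟨ cong (_· conj w′) eq ⟨
      z · w′ · conj w′     ≡⟨ ·-·-conj z w′ ⟩
      norm w′ ⊙ z          ≡⟨ cong (_⊙ z) (twist-norm t) ⟩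
      (P * P) ⊙ z          ≡⟨ ⊙-⊙ P P z ⟨
      P ⊙ P ⊙ z            ∎))

    ↦-⊙ : ∀ k {z z′} → z ↦ z′ → k ⊙ z ↦ k ⊙ z′
    ↦-⊙ k {z} {z′} (via {w′} t eq) = via t (begin
      k ⊙ z · w′      ≡⟨ ⊙-· k z w′ ⟩
      k ⊙ (z · w′)    ≡⟨ cong (k ⊙_) eq ⟩
      k ⊙ P ⊙ z′      ≡⟨ ⊙-⊙ k P z′ ⟩
      (k * P) ⊙ z′    ≡⟨ cong (_⊙ z′) (ℤP.*-comm k P) ⟩
      (P * k) ⊙ z′    ≡⟨ ⊙-⊙ P k z′ ⟨
      P ⊙ k ⊙ z′      ∎)

    ↦-conj : ∀ {z z′} → z ↦ z′ → conj z ↦ conj z′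
    ↦-conj {z} {z′} (via {w′} t eq) = via (twist-conj t) (begin
      conj z · conj w′  ≡⟨ conj-· z w′ ⟨
      conj (z · w′)     ≡⟨ cong conj eq ⟩
      conj (P ⊙ z′)     ≡⟨ conj-⊙ P z′ ⟩
      P ⊙ conj z′       ∎)

    ∣re-twist⇒↦ : ∀ {z w′} → Twist w′ → P ∣ norm z → P ∣ proj₁ (z · w′) → ∃ (z ↦_)
    ∣re-twist⇒↦ {z} {w′} t P∣norm P∣re = proj₁ quotient , via t (proj₂ quotient)
      where
      P∣norm-· : P ∣ norm (z · w′)
      P∣norm-· = subst (P ∣_) (sym (norm-· z w′)) (∣m⇒∣m*n (norm w′) P∣norm)
      P∣im : P ∣ proj₂ (z · w′)
      P∣im = ∣form∧∣x⇒∣y p-prime {+ 216} {proj₁ (z · w′)} {proj₂ (z · w′)}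
                         P∣norm-· P∤216 P∣re
      quotient = ∣-components⇒⊙ {P} {z · w′} P∣re P∣im

    -- Re(z·w) · Re(z·w̄) = N(z)·u² − 216·y²·N(w) is divisible by p.
    ↦-exists : ∀ {z} → P ∣ norm z → ∃ (z ↦_)
    ↦-exists {z} P∣norm =
      [ ∣re-twist⇒↦ {z} {w} (inj₁ refl) P∣norm , ∣re-twist⇒↦ {z} {conj w} (inj₂ refl) P∣norm ]′
        (prime∣*⇒∣⊎∣ p-prime (proj₁ (z · w)) (proj₁ (z · conj w)) P∣re*re)
      where
      P∣re*re : P ∣ proj₁ (z · w) * proj₁ (z · conj w)
      P∣re*re = subst (P ∣_) (sym (re-·-conj-product z w))
        (∣m∣n⇒∣m-n (∣m⇒∣m*n (proj₁ w * proj₁ w) P∣norm)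
                   (∣n⇒∣m*n (+ 216 * (proj₂ z * proj₂ z)) (subst (P ∣_) (sym norm-w) P∣P*P)))

    ¬∣re-·-both : ∀ {z} → ¬ P ∣ proj₁ z → ¬ (P ∣ proj₁ (z · w) × P ∣ proj₁ (z · conj w))
    ¬∣re-·-both {z} P∤x (P∣re , P∣re′) =
      [ P∤2 , [ P∤x , P∤re-w ]′ ∘ prime∣*⇒∣⊎∣ p-prime (proj₁ z) (proj₁ w) ]′
        (prime∣*⇒∣⊎∣ p-prime (+ 2) (proj₁ z * proj₁ w)
          (subst (P ∣_) (re-·-conj-sum z w) (∣m∣n⇒∣m+n P∣re P∣re′)))

    ↦-functional : ∀ {z z′ z″} → ¬ P ∣ proj₁ z → z ↦ z′ → z ↦ z″ → z′ ≡ z″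
    ↦-functional _ (via (inj₁ refl) eq′) (via (inj₁ refl) eq″) = ⊙-cancel (trans (sym eq′) eq″)
    ↦-functional _ (via (inj₂ refl) eq′) (via (inj₂ refl) eq″) = ⊙-cancel (trans (sym eq′) eq″)
    ↦-functional {z} {z′} {z″} P∤x (via (inj₁ refl) eq′) (via (inj₂ refl) eq″) =
      contradiction (⊙⇒∣re {z · w} {z′} eq′ , ⊙⇒∣re {z · conj w} {z″} eq″)
                    (¬∣re-·-both {z} P∤x)
    ↦-functional {z} {z′} {z″} P∤x (via (inj₂ refl) eq′) (via (inj₁ refl) eq″) =
      contradiction (⊙⇒∣re {z · w} {z″} eq″ , ⊙⇒∣re {z · conj w} {z′} eq′)
                    (¬∣re-·-both {z} P∤x)

    ↦-pres-∣ : ∀ {d z z′} → z ↦ z′ → d ∣ proj₁ z → d ∣ proj₂ z →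
               d ∣ P * proj₁ z′ × d ∣ P * proj₂ z′
    ↦-pres-∣ {d} {z} (via {w′} t eq) d∣x d∣y =
      subst (d ∣_) (cong proj₁ eq) (proj₁ d∣z·w′) , subst (d ∣_) (cong proj₂ eq) (proj₂ d∣z·w′)
      where d∣z·w′ = ∣-· {d} {z} {w′} d∣x d∣y

    ↦-primitive : ∀ {z z′} → z ↦ z′ → gcd (proj₁ z) (proj₂ z) ≡ + 1 →
                  ¬ (P ∣ proj₁ z′ × P ∣ proj₂ z′) → gcd (proj₁ z′) (proj₂ z′) ≡ + 1
    ↦-primitive {x , y} {x′ , y′} z↦z′ gcd≡1 P∤z′ =
      cong +_ (by-cases (prime⇒irreducible p-prime (ℕGCD.gcd[m,n]∣n g p)))
      where
      g = ℕGCD.gcd ℤ.∣ x′ ∣ ℤ.∣ y′ ∣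
      g∣x′ = ℕGCD.gcd[m,n]∣m ℤ.∣ x′ ∣ ℤ.∣ y′ ∣
      g∣y′ = ℕGCD.gcd[m,n]∣n ℤ.∣ x′ ∣ ℤ.∣ y′ ∣
      g∣P⊙z = ↦-pres-∣ {+ g} (↦-sym z↦z′) (∣ᵤ⇒∣ g∣x′) (∣ᵤ⇒∣ g∣y′)
      g∣p*x : g ℕ∣.∣ p ℕ.* ℤ.∣ x ∣
      g∣p*x = subst (g ℕ∣.∣_) (ℤP.abs-* P x) (∣⇒∣ᵤ (proj₁ g∣P⊙z))
      g∣p*y : g ℕ∣.∣ p ℕ.* ℤ.∣ y ∣
      g∣p*y = subst (g ℕ∣.∣_) (ℤP.abs-* P y) (∣⇒∣ᵤ (proj₂ g∣P⊙z))
      by-cases : ℕGCD.gcd g p ≡ 1 ⊎ ℕGCD.gcd g p ≡ p → g ≡ 1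
      by-cases (inj₁ gcd[g,p]≡1) = ℕ∣.∣1⇒≡1 (subst (g ℕ∣.∣_) (cong ℤ.∣_∣ gcd≡1)
        (ℕGCD.gcd-greatest (coprime-divisor g⊥p g∣p*x) (coprime-divisor g⊥p g∣p*y)))
        where g⊥p = gcd≡1⇒coprime gcd[g,p]≡1
      by-cases (inj₂ gcd[g,p]≡p) =
        contradiction (∣ᵤ⇒∣ (ℕ∣.∣-trans p∣g g∣x′) , ∣ᵤ⇒∣ (ℕ∣.∣-trans p∣g g∣y′)) P∤z′
        where p∣g = subst (ℕ∣._∣ g) gcd[g,p]≡p (ℕGCD.gcd[m,n]∣m g p)

    ↦-⊙-self : ∀ {z} ε → z ↦ ε ⊙ z → norm z ≡ 0ℤ
    ↦-⊙-self {z} ε (via {w′} t eq) =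
      [ id , (λ im≡0 → contradiction (divides 0ℤ im≡0) (twist-∤im t)) ]′
        (ℤP.i*j≡0⇒i≡0∨j≡0 (norm z) {proj₂ w′}
          (trans (sym (cong proj₂ (conj-·-cancel {P} {z} {w′} {ε ⊙ z} eq))) P*im≡0))
      where
      P*im≡0 : P * proj₂ (conj z · ε ⊙ z) ≡ 0ℤ
      P*im≡0 = begin
        P * proj₂ (conj z · ε ⊙ z)   ≡⟨ cong (λ v → P * proj₂ v) (·-⊙ ε (conj z) z) ⟩
        P * (ε * proj₂ (conj z · z)) ≡⟨ cong (λ t → P * (ε * t)) (im-conj-·-self z) ⟩
        P * (ε * 0ℤ)                 ≡⟨ cong (P *_) (ℤP.*-zeroʳ ε) ⟩
        P * 0ℤ                       ≡⟨ ℤP.*-zeroʳ P ⟩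
        0ℤ                           ∎

    ↦-⊙-conj : ∀ {z} ε → z ↦ ε ⊙ conj z → P * (ε * proj₁ (z · z)) ≡ norm z * proj₁ w
    ↦-⊙-conj {z} ε (via {w′} t eq) = begin
      P * (ε * proj₁ (z · z))
        ≡⟨⟩
      proj₁ (P ⊙ ε ⊙ conj (z · z))
        ≡⟨ cong (λ v → proj₁ (P ⊙ ε ⊙ v)) (conj-· z z) ⟩
      proj₁ (P ⊙ ε ⊙ (conj z · conj z))
        ≡⟨ cong (λ v → proj₁ (P ⊙ v)) (·-⊙ ε (conj z) (conj z)) ⟨
      proj₁ (P ⊙ (conj z · ε ⊙ conj z))
        ≡⟨ cong proj₁ (conj-·-cancel {P} {z} {w′} {ε ⊙ conj z} eq) ⟩
      norm z * proj₁ w′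
        ≡⟨ cong (norm z *_) (twist-re t) ⟩
      norm z * proj₁ w ∎

    ↦-respects-abs : ∀ {z z′} z₀ → z ↦ z′ → abs z₀ ≡ abs z →
                     ∃ λ z₀′ → z₀ ↦ z₀′ × abs z₀′ ≡ abs z′
    ↦-respects-abs {z} {z′} z₀ z↦z′ eq = by-cases (same-abs z₀ z eq)
      where
      by-cases : (∃ λ ε → Unit ε × (z₀ ≡ ε ⊙ z ⊎ z₀ ≡ ε ⊙ conj z)) →
                 ∃ λ z₀′ → z₀ ↦ z₀′ × abs z₀′ ≡ abs z′
      by-cases (ε , unit , inj₁ z₀≡εz) =
        ε ⊙ z′ , subst (_↦ ε ⊙ z′) (sym z₀≡εz) (↦-⊙ ε z↦z′) , abs-unit-⊙ unit z′
      by-cases (ε , unit , inj₂ z₀≡εz̄) =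
        ε ⊙ conj z′ ,
        subst (_↦ ε ⊙ conj z′) (sym z₀≡εz̄) (↦-⊙ ε (↦-conj {z} {z′} z↦z′)) ,
        trans (abs-unit-⊙ unit (conj z′)) (abs-conj z′)

    ↦-same-abs : ∀ {z z′} → z ↦ z′ → abs z′ ≡ abs z →
                 norm z ≡ 0ℤ ⊎ ∃ λ ε → Unit ε × P * (ε * proj₁ (z · z)) ≡ norm z * proj₁ w
    ↦-same-abs {z} {z′} z↦z′ eq = by-cases (same-abs z′ z eq)
      where
      by-cases : (∃ λ ε → Unit ε × (z′ ≡ ε ⊙ z ⊎ z′ ≡ ε ⊙ conj z)) →
                 norm z ≡ 0ℤ ⊎ ∃ λ ε → Unit ε × P * (ε * proj₁ (z · z)) ≡ norm z * proj₁ w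
      by-cases (ε , unit , inj₁ z′≡εz) = inj₁ (↦-⊙-self ε (subst (z ↦_) z′≡εz z↦z′))
      by-cases (ε , unit , inj₂ z′≡εz̄) =
        inj₂ (ε , unit , ↦-⊙-conj ε (subst (z ↦_) z′≡εz̄ z↦z′))

module Involution (p m : ℕ) (p∈𝒫 : InP p) (p∤6 : ¬ p ℕ∣.∣ 6) .{{m≢0 : ℕ.NonZero m}}
                  (m⊥p : Coprime m p) (m⊥6 : Coprime m 6) where

  p-prime = proj₁ p∈𝒫
  open AtPrime p p-prime p∤6

  twist = 𝒫⇒twist p∈𝒫
  w = proj₁ twist
  open TwistMap w (proj₁ (proj₂ twist)) (proj₂ (proj₂ twist))

  M : ℤ
  M = + m

  N≡P*M : + (p ℕ.* m) ≡ P * M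
  N≡P*M = ℤP.pos-* p m

  P∣N : P ∣ + (p ℕ.* m)
  P∣N = ∣ᵤ⇒∣ (ℕ∣.m∣m*n m)

  N≢0 : + (p ℕ.* m) ≢ 0ℤ
  N≢0 eq = ℕ.≢-nonZero⁻¹ (p ℕ.* m) {{ℕP.m*n≢0 p m {{prime⇒nonZero p-prime}}}} (ℤP.+-injective eq)

  P∤M : ¬ P ∣ M
  P∤M P∣M = ¬prime[1] (subst Prime (m⊥p (∣⇒∣ᵤ P∣M , ℕ∣.∣-refl)) p-prime)

  ↦-preserves-X : ∀ {z z′} → z ↦ z′ → X p m z → X p m z′
  ↦-preserves-X {z} {z′} z↦z′ (norm≡N , gcd≡1) = norm′≡N , ↦-primitive z↦z′ gcd≡1 P∤both
    where
    norm′≡N : norm z′ ≡ + (p ℕ.* m)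
    norm′≡N = trans (↦-norm z↦z′) norm≡N
    P∣M-from : ∀ {v} → z′ ≡ P ⊙ v → P ∣ M
    P∣M-from {v} z′≡Pv = divides (norm v) (trans M≡P*norm (ℤP.*-comm P (norm v)))
      where
      M≡P*norm : M ≡ P * norm v
      M≡P*norm = ℤP.*-cancelˡ-≡ P M (P * norm v) (begin
        P * M              ≡⟨ trans (sym N≡P*M) (sym norm′≡N) ⟩
        norm z′            ≡⟨ cong norm z′≡Pv ⟩
        norm (P ⊙ v)       ≡⟨ norm-⊙ P v ⟩
        P * P * norm v     ≡⟨ ℤP.*-assoc P P (norm v) ⟩
        P * (P * norm v)   ∎)
    P∤both : ¬ (P ∣ proj₁ z′ × P ∣ proj₂ z′)
    P∤both (P∣x′ , P∣y′) = P∤M (P∣M-from (proj₂ (∣-components⇒⊙ {P} {z′} P∣x′ P∣y′)))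

  -- Opaque, so that the type checker never unfolds the case split on divisibility that builds the image.
  opaque
    image : ∀ z → X p m z → ∃ (z ↦_)
    image z (norm≡N , _) = ↦-exists {z} (subst (P ∣_) (sym norm≡N) P∣N)

  Positive : Set
  Positive = Σ (ℕ × ℕ) (X p m ∘ embed)

  X-embed-abs : ∀ z → X p m z → X p m (embed (abs z))
  X-embed-abs z = PrimSol-abs {z = z} {z′ = embed (abs z)} refl

  ψ : Positive → Positive
  ψ (n , s) = abs z′ , X-embed-abs z′ (↦-preserves-X (proj₂ (image (embed n) s)) s)
    where z′ = proj₁ (image (embed n) s)

  ψ-involutive : ∀ a → ψ (ψ a) ≡ a
  ψ-involutive (n , s) = Σ-≡-irrelevant (PrimSol-irrelevant (+ (p ℕ.* m)) ∘ embed) (begin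
    abs (proj₁ (image z₀ s₀))
      ≡⟨ cong abs (↦-functional P∤re-z₀ (proj₂ (image z₀ s₀)) z₀↦z₀′) ⟩
    abs z₀′
      ≡⟨ abs-z₀′ ⟩
    n ∎)
    where
    z′ = proj₁ (image (embed n) s)
    z↦z′ = proj₂ (image (embed n) s)
    z₀ = embed (abs z′)
    s₀ : X p m z₀
    s₀ = X-embed-abs z′ (↦-preserves-X z↦z′ s)
    P∤re-z₀ : ¬ P ∣ proj₁ z₀
    P∤re-z₀ =
      primitive⇒∤re {proj₁ z₀} {proj₂ z₀} (subst (P ∣_) (sym (proj₁ s₀)) P∣N) (proj₂ s₀)
    respects = ↦-respects-abs z₀ (↦-sym z↦z′) refl
    z₀′ = proj₁ respects
    z₀↦z₀′ = proj₁ (proj₂ respects)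
    abs-z₀′ = proj₂ (proj₂ respects)

  ψ-free : m ≢ 1 → ∀ a → ψ a ≢ a
  ψ-free m≢1 (n , s@(norm≡N , gcd≡1)) ψa≡a =
    by-cases (↦-same-abs (proj₂ (image z s)) (cong proj₁ ψa≡a))
    where
    z = embed n
    M∣norm : M ∣ norm z
    M∣norm = divides P (trans norm≡N N≡P*M)
    M∣re-square : ∀ ε → Unit ε → P * (ε * proj₁ (z · z)) ≡ norm z * proj₁ w → M ∣ proj₁ (z · z)
    M∣re-square ε unit eq = unit-∣ unit (divides (proj₁ w)
      (ℤP.*-cancelˡ-≡ P (ε * proj₁ (z · z)) (proj₁ w * M) (begin
        P * (ε * proj₁ (z · z))  ≡⟨ eq ⟩
        norm z * proj₁ w         ≡⟨ cong (_* proj₁ w) (trans norm≡N N≡P*M) ⟩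
        P * M * proj₁ w          ≡⟨ ℤP.*-assoc P M (proj₁ w) ⟩
        P * (M * proj₁ w)        ≡⟨ cong (P *_) (ℤP.*-comm M (proj₁ w)) ⟩
        P * (proj₁ w * M)        ∎)))
    by-cases : norm z ≡ 0ℤ ⊎ (∃ λ ε → Unit ε × P * (ε * proj₁ (z · z)) ≡ norm z * proj₁ w) → ⊥
    by-cases (inj₁ norm≡0)          = N≢0 (trans (sym norm≡N) norm≡0)
    by-cases (inj₂ (ε , unit , eq)) =
      m≢1 (m∣x²±216y²⇒m≡1 {m} {proj₁ z} {proj₂ z} m⊥6 gcd≡1 M∣norm (M∣re-square ε unit eq))

corollary2p8 : (p m : ℕ) → InP p → m ℕ.> 0 → Coprime m p → (p ℕ.* m) ℕ.% 24 ≡ 1 →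
    ∃ λ (n : ℕ) → HasCard (X p m) n × (m ℕ.> 1 → 8 ℕ∣.∣ n) × (m ≡ 1 → n ≡ 4)
corollary2p8 p m p∈𝒫 m>0 m⊥p pm%24≡1 =
  2 ℕ.* (2 ℕ.* c) , card ,
  (λ m>1 → ℕ∣.*-monoʳ-∣ 2 (ℕ∣.*-monoʳ-∣ 2 (c-even (λ m≡1 → ℕP.<⇒≢ m>1 (sym m≡1))))) ,
  (λ m≡1 → cong (λ k → 2 ℕ.* (2 ℕ.* k)) (c≡1 m≡1))
  where
  p-prime = proj₁ p∈𝒫
  coprime-6 = *%24≡1⇒coprime-6 p m pm%24≡1
  p∤6 : ¬ p ℕ∣.∣ 6
  p∤6 p∣6 = ¬prime[1] (subst Prime (proj₁ coprime-6 (ℕ∣.∣-refl , p∣6)) p-prime)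
  open AtPrime p p-prime p∤6
  positive = finite-positive-PrimSol (p ℕ.* m)
  c = proj₁ positive
  card : HasCard (X p m) (2 ℕ.* (2 ℕ.* c))
  card = ↔-sym (solutions↔signs×positive (∣ᵤ⇒∣ (ℕ∣.m∣m*n m))) ↔-∘ signs×-↔ (proj₂ positive)
  c-even : m ≢ 1 → 2 ℕ∣.∣ c
  c-even m≢1 = free-involution⇒even (proj₂ positive) ψ ψ-involutive (ψ-free m≢1)
    where open Involution p m p∈𝒫 p∤6 {{ℕ.>-nonZero m>0}} m⊥p (proj₂ coprime-6)
  c≡1 : m ≡ 1 → c ≡ 1
  c≡1 m≡1 = positive-card≡1 p%24≡1 p∈𝒫
              (subst (λ k → Fin c ↔ Σ (ℕ × ℕ) (PrimSol (+ k) ∘ embed)) pm≡p (proj₂ positive))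
    where
    pm≡p = trans (cong (p ℕ.*_) m≡1) (ℕP.*-identityʳ p)
    p%24≡1 = trans (cong (ℕ._% 24) (sym pm≡p)) pm%24≡1
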